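{- A map $f: A\to B$ in a dagger category $(\mathbb{X},\dagger)$ has a Moore-Penrose inverse if and only if there exist $\dagger$-idempotents $e_1: A\to A$ and $e_2: B\to B$ such that $f: (A,e_1)\to(B,e_2)$ is an isomorphism in $(\mathsf{Split}_\dagger(\mathbb{X}),\dagger)$. Explicitly: (i) if $f$ has a Moore-Penrose inverse $f^\circ: B\to A$, then $f: (A, ff^\circ)\to (B, f^\circ f)$ is an isomorphism in $\mathsf{Split}_\dagger(\mathbb{X})$ with inverse $f^\circ: (B, f^\circ f)\to(A, ff^\circ)$; (ii) if $f: (A,e_1)\to(B,e_2)$ is an isomorphism in $\mathsf{Split}_\dagger(\mathbb{X})$ with inverse $g: (B,e_2)\to(A,e_1)$, then $f$ is Moore-Penrose invertible in $(\mathbb{X},\dagger)$ with Moore-Penrose inverse $g$.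
   Context: Composition is in diagrammatic order. A dagger category is a category with an identity-on-objects contravariant involutive functor $\dagger$. A Moore-Penrose inverse of $f: A\to B$ is $f^\circ: B\to A$ with $ff^\circ f = f$, $f^\circ f f^\circ = f^\circ$, $(ff^\circ)^\dagger = ff^\circ$, $(f^\circ f)^\dagger = f^\circ f$. A $\dagger$-idempotent is $e: A\to A$ with $ee = e = e^\dagger$. $\mathsf{Split}_\dagger(\mathbb{X})$ has objects pairs $(A,e)$ with $e$ a $\dagger$-idempotent on $A$; maps $f: (A_1,e_1)\to(A_2,e_2)$ are maps $f: A_1\to A_2$ of $\mathbb{X}$ with $e_1 f e_2 = f$; composition and dagger are as in $\mathbb{X}$, and the identity on $(A,e)$ is $e$. -}

module Defs where

open import Level using (Level; _⊔_; suc)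
open import Data.Product using (Σ; Σ-syntax; _×_; _,_; proj₁; proj₂)
open import Relation.Binary.PropositionalEquality using (_≡_)

-- A dagger category, with composition written in diagrammatic order:
-- for f : A → B and g : B → C, f ⨾ g : A → C ("first f, then g").
-- Hom-sets are equipped with propositional equality.
record DaggerCategory (o ℓ : Level) : Set (suc (o ⊔ ℓ)) where
  infixl 7 _⨾_
  infix 9 _†
  field
    Obj  : Set o
    Hom  : Obj → Obj → Set ℓ
    id   : ∀ {A} → Hom A A
    _⨾_  : ∀ {A B C} → Hom A B → Hom B C → Hom A C
    assoc : ∀ {A B C D} (f : Hom A B) (g : Hom B C) (h : Hom C D) →
            (f ⨾ g) ⨾ h ≡ f ⨾ (g ⨾ h)
    identityˡ : ∀ {A B} (f : Hom A B) → id ⨾ f ≡ f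
    identityʳ : ∀ {A B} (f : Hom A B) → f ⨾ id ≡ f
    _†   : ∀ {A B} → Hom A B → Hom B A
    †-id : ∀ {A} → (id {A}) † ≡ id
    †-⨾  : ∀ {A B C} (f : Hom A B) (g : Hom B C) → (f ⨾ g) † ≡ g † ⨾ f †
    †-involutive : ∀ {A B} (f : Hom A B) → (f †) † ≡ f

module _ {o ℓ : Level} (X : DaggerCategory o ℓ) where
  open DaggerCategory X

  record IsMPInverse {A B : Obj} (f : Hom A B) (g : Hom B A) : Set ℓ where
    field
      mp1 : f ⨾ g ⨾ f ≡ f
      mp2 : g ⨾ f ⨾ g ≡ g
      mp3 : (f ⨾ g) † ≡ f ⨾ g
      mp4 : (g ⨾ f) † ≡ g ⨾ f

  HasMPInverse : {A B : Obj} (f : Hom A B) → Set ℓ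
  HasMPInverse {A} {B} f = Σ[ g ∈ Hom B A ] IsMPInverse f g

  record IsDaggerIdempotent {A : Obj} (e : Hom A A) : Set ℓ where
    field
      idem     : e ⨾ e ≡ e
      selfAdj  : e † ≡ e

  SplitObj : Set (o ⊔ ℓ)
  SplitObj = Σ[ A ∈ Obj ] Σ[ e ∈ Hom A A ] IsDaggerIdempotent e

  carrier : SplitObj → Obj
  carrier (A , _) = A

  idem : (P : SplitObj) → Hom (carrier P) (carrier P)
  idem (_ , e , _) = e

  SplitHom : SplitObj → SplitObj → Set ℓ
  SplitHom P Q = Σ[ f ∈ Hom (carrier P) (carrier Q) ] idem P ⨾ f ⨾ idem Q ≡ f

  -- isomorphism in Split†(X): composition and identities of Split†(X) are
  -- those of X (identity on (A , e) is e), and two maps of Split†(X) are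
  -- equal iff their underlying maps in X are equal.
  IsSplitIso : {P Q : SplitObj} → SplitHom P Q → SplitHom Q P → Set ℓ
  IsSplitIso {P} {Q} (f , _) (g , _) = (f ⨾ g ≡ idem P) × (g ⨾ f ≡ idem Q)

{-# OPTIONS --safe #-}
module Submission where

open import Defs
open import Level using (Level)
open import Data.Product using (Σ; Σ-syntax; _×_; _,_)
open import Relation.Binary.PropositionalEquality using (_≡_; refl; sym; cong; subst; module ≡-Reasoning)
open import Function.Bundles using (_⇔_; mk⇔)

-- For a Moore-Penrose inverse g, the regularity laws f g f = f and g f g = g make
-- f g and g f idempotents fixing f and g, and the symmetry laws make them
-- self-adjoint. Conversely, in Split† the composites f g and g f are the
-- †-idempotents e₁ and e₂ themselves, and e₁ f = f since f is a map of Split†.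

module _ {o ℓ : Level} (X : DaggerCategory o ℓ) where
  open DaggerCategory X
  open ≡-Reasoning

  IsMPInverse-sym : {A B : Obj} {f : Hom A B} {g : Hom B A} →
    IsMPInverse X f g → IsMPInverse X g f
  IsMPInverse-sym m = record { mp1 = mp2 ; mp2 = mp1 ; mp3 = mp4 ; mp4 = mp3 }
    where open IsMPInverse m

  regular⇒idempotent : {A B : Obj} {f : Hom A B} {g : Hom B A} →
    f ⨾ g ⨾ f ≡ f → (f ⨾ g) ⨾ (f ⨾ g) ≡ f ⨾ g
  regular⇒idempotent {f = f} {g} fgf≡f = begin
    (f ⨾ g) ⨾ (f ⨾ g)  ≡⟨ assoc (f ⨾ g) f g ⟨
    f ⨾ g ⨾ f ⨾ g      ≡⟨ cong (_⨾ g) fgf≡f ⟩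
    f ⨾ g              ∎

  regular⇒absorbs : {A B : Obj} {f : Hom A B} {g : Hom B A} →
    f ⨾ g ⨾ f ≡ f → (f ⨾ g) ⨾ f ⨾ (g ⨾ f) ≡ f
  regular⇒absorbs {f = f} {g} fgf≡f = begin
    (f ⨾ g) ⨾ f ⨾ (g ⨾ f)  ≡⟨ cong (_⨾ (g ⨾ f)) fgf≡f ⟩
    f ⨾ (g ⨾ f)            ≡⟨ assoc f g f ⟨
    f ⨾ g ⨾ f              ≡⟨ fgf≡f ⟩
    f                      ∎

  MPInverse⇒leftIdempotent : {A B : Obj} {f : Hom A B} {g : Hom B A} →
    IsMPInverse X f g → IsDaggerIdempotent X (f ⨾ g)
  MPInverse⇒leftIdempotent m = record
    { idem = regular⇒idempotent (IsMPInverse.mp1 m) ; selfAdj = IsMPInverse.mp3 m }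

  idempotent-absorbˡ : {A B : Obj} {e₁ : Hom A A} {e₂ : Hom B B} {f : Hom A B} →
    e₁ ⨾ e₁ ≡ e₁ → e₁ ⨾ f ⨾ e₂ ≡ f → e₁ ⨾ f ≡ f
  idempotent-absorbˡ {e₁ = e₁} {e₂} {f} e₁e₁≡e₁ e₁fe₂≡f = begin
    e₁ ⨾ f                ≡⟨ cong (e₁ ⨾_) e₁fe₂≡f ⟨
    e₁ ⨾ (e₁ ⨾ f ⨾ e₂)    ≡⟨ assoc e₁ (e₁ ⨾ f) e₂ ⟨
    e₁ ⨾ (e₁ ⨾ f) ⨾ e₂    ≡⟨ cong (_⨾ e₂) (assoc e₁ e₁ f) ⟨
    e₁ ⨾ e₁ ⨾ f ⨾ e₂      ≡⟨ cong (λ e → e ⨾ f ⨾ e₂) e₁e₁≡e₁ ⟩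
    e₁ ⨾ f ⨾ e₂           ≡⟨ e₁fe₂≡f ⟩
    f                     ∎

  MPInverse⇒splitIso : {A B : Obj} (f : Hom A B) (g : Hom B A) → IsMPInverse X f g →
      Σ[ i₁ ∈ IsDaggerIdempotent X (f ⨾ g) ]
      Σ[ i₂ ∈ IsDaggerIdempotent X (g ⨾ f) ]
      Σ[ pf ∈ (f ⨾ g) ⨾ f ⨾ (g ⨾ f) ≡ f ]
      Σ[ pg ∈ (g ⨾ f) ⨾ g ⨾ (f ⨾ g) ≡ g ]
        IsSplitIso X {A , f ⨾ g , i₁} {B , g ⨾ f , i₂} (f , pf) (g , pg)
  MPInverse⇒splitIso f g m =
    MPInverse⇒leftIdempotent m ,
    MPInverse⇒leftIdempotent (IsMPInverse-sym m) ,
    regular⇒absorbs (IsMPInverse.mp1 m) ,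
    regular⇒absorbs (IsMPInverse.mp2 m) ,
    refl , refl

  splitIso⇒MPInverse : {A B : Obj} (f : Hom A B)
    (e₁ : Hom A A) (i₁ : IsDaggerIdempotent X e₁)
    (e₂ : Hom B B) (i₂ : IsDaggerIdempotent X e₂)
    (pf : e₁ ⨾ f ⨾ e₂ ≡ f) (g : Hom B A) (pg : e₂ ⨾ g ⨾ e₁ ≡ g) →
    IsSplitIso X {A , e₁ , i₁} {B , e₂ , i₂} (f , pf) (g , pg) →
    IsMPInverse X f g
  splitIso⇒MPInverse f e₁ i₁ e₂ i₂ pf g pg (fg≡e₁ , gf≡e₂) = record
    { mp1 = subst (λ e → e ⨾ f ≡ f) (sym fg≡e₁) (idempotent-absorbˡ (IsDaggerIdempotent.idem i₁) pf)
    ; mp2 = subst (λ e → e ⨾ g ≡ g) (sym gf≡e₂) (idempotent-absorbˡ (IsDaggerIdempotent.idem i₂) pg)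
    ; mp3 = subst (λ e → e † ≡ e) (sym fg≡e₁) (IsDaggerIdempotent.selfAdj i₁)
    ; mp4 = subst (λ e → e † ≡ e) (sym gf≡e₂) (IsDaggerIdempotent.selfAdj i₂)
    }

mainTheorem11 : {o ℓ : Level} (X : DaggerCategory o ℓ) →
    let open DaggerCategory X in
    {A B : Obj} (f : Hom A B) →
    (HasMPInverse X f ⇔
      (Σ[ e₁ ∈ Hom A A ] Σ[ i₁ ∈ IsDaggerIdempotent X e₁ ]
       Σ[ e₂ ∈ Hom B B ] Σ[ i₂ ∈ IsDaggerIdempotent X e₂ ]
       Σ[ pf ∈ e₁ ⨾ f ⨾ e₂ ≡ f ]
       Σ[ g ∈ SplitHom X (B , e₂ , i₂) (A , e₁ , i₁) ]
         IsSplitIso X {A , e₁ , i₁} {B , e₂ , i₂} (f , pf) g))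
    ×
    ((g : Hom B A) → IsMPInverse X f g →
      Σ[ i₁ ∈ IsDaggerIdempotent X (f ⨾ g) ]
      Σ[ i₂ ∈ IsDaggerIdempotent X (g ⨾ f) ]
      Σ[ pf ∈ (f ⨾ g) ⨾ f ⨾ (g ⨾ f) ≡ f ]
      Σ[ pg ∈ (g ⨾ f) ⨾ g ⨾ (f ⨾ g) ≡ g ]
        IsSplitIso X {A , f ⨾ g , i₁} {B , g ⨾ f , i₂} (f , pf) (g , pg))
    ×
    ((e₁ : Hom A A) (i₁ : IsDaggerIdempotent X e₁)
     (e₂ : Hom B B) (i₂ : IsDaggerIdempotent X e₂)
     (pf : e₁ ⨾ f ⨾ e₂ ≡ f)
     (g : Hom B A) (pg : e₂ ⨾ g ⨾ e₁ ≡ g) →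
       IsSplitIso X {A , e₁ , i₁} {B , e₂ , i₂} (f , pf) (g , pg) →
       IsMPInverse X f g)
mainTheorem11 X f =
  mk⇔ (λ { (g , m) →
          let (i₁ , i₂ , pf , pg , iso) = MPInverse⇒splitIso X f g m
          in _ , i₁ , _ , i₂ , pf , (g , pg) , iso })
      (λ { (e₁ , i₁ , e₂ , i₂ , pf , (g , pg) , iso) →
          g , splitIso⇒MPInverse X f e₁ i₁ e₂ i₂ pf g pg iso }) ,
  MPInverse⇒splitIso X f ,
  splitIso⇒MPInverse X f
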